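{- Let $H$ be a graph possibly with loops, let $G$ be a finite multigraph without loops with an $H$-coloring $c$, and let $M_J$ be the joint matching of $L_2^H(G)$. Let $C=(f(x_1,e_1),f(y_1,e_1),f(x_2,e_2),f(y_2,e_2),\ldots,f(x_q,e_q),f(y_q,e_q),f(x_1,e_1))$, where each $e_i$ is an edge of $G$ with ends $x_i,y_i$, be a cycle in $L_2^H(G)$ whose edges alternate between $E(L_2^H(G))\setminus M_J$ and $M_J$. Construct $P$ as follows: start with $P=(x_1,e_1,y_1)$; for $k=2,\ldots,q$ in turn, if $e_{k-1}$ and $e_k$ are parallel with $x_k=x_{k-1}$ and $y_k=y_{k-1}$, change lanes, i.e. place $e_k$ immediately after $e_{k-1}$ in the same block (so $P$ now ends $\ldots,e_{k-1},e_k,y_k$); otherwise continue $P$ by the edge $e_k$ (append $e_k,y_k$). Then the resulting $P$ is a closed dynamic $H$-trail in $G$.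
   Context: An $H$-coloring of $G$ is a map $c:E(G)\to V(H)$. Two distinct edges of $G$ are parallel if they have the same two end vertices. A dynamic $H$-walk in $G$ is a sequence $W=(v_0,e_0^1,\ldots,e_0^{k_0},v_1,e_1^1,\ldots,v_{n-1},e_{n-1}^1,\ldots,e_{n-1}^{k_{n-1}},v_n)$ with $n\ge1$, $k_i\ge 1$, each $e_i^j$ an edge joining $v_i$ and $v_{i+1}$, such that $c(e_i^{k_i})c(e_{i+1}^1)\in E(H)$ for each $i\in\{0,\ldots,n-2\}$. A dynamic $H$-trail is one with no repeated edge; it is closed if either $v_0=v_n$ and $c(e_{n-1}^{k_{n-1}})c(e_0^1)\in E(H)$, or $v_1=v_n$ and $e_{n-1}^{k_{n-1}}$ and $e_0^1$ are parallel. $L_2^H(G)$ is the simple graph with vertex set $\{f(x,e): e\in E(G),\ x \text{ an end of } e\}$, in which $f(x,e)f(y,e)$ is an edge for every edge $e$ of $G$ with ends $x,y$; $f(u,e)$ and $f(u,g)$ are adjacent iff $e\ne g$ and $c(e)c(g)\in E(H)$; and $f(u,e),f(v,g)$ with $u\ne v$ are adjacent iff $e,g$ are distinct parallel edges; there are no other edges. The joint matching is $M_J=\{f(x,e)f(y,e): e\in E(G)\text{ with ends }x,y\}$, a perfect matching of $L_2^H(G)$. -}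

module Defs where

open import Data.Nat using (ℕ; zero; suc; _≤_)
open import Data.Fin using (Fin; zero; suc; _≟_)
open import Data.Bool using (Bool; true; false; not; if_then_else_)
open import Data.Product using (Σ; _×_; _,_; proj₁; proj₂)
open import Data.Sum using (_⊎_; inj₁; inj₂)
open import Data.List using (List; []; _∷_; tabulate)
open import Data.Unit using (⊤)
open import Data.List.NonEmpty as L⁺ using (List⁺; _∷_; [_]; _⁺∷ʳ_; head; last; toList)
open import Data.List.Relation.Unary.All using (All)
open import Data.List.Relation.Unary.Unique.Propositional using (Unique)
open import Relation.Binary.PropositionalEquality using (_≡_; _≢_)
open import Relation.Nullary using (¬_; Dec; yes; no)
open import Relation.Nullary.Decidable using (_×-dec_; _⊎-dec_; ¬?)

record Graph : Set₁ where
  field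
    V    : Set
    Adj  : V → V → Set
    sym  : ∀ {u v} → Adj u v → Adj v u

record Multigraph : Set where
  field
    nV nE  : ℕ
    end₁   : Fin nE → Fin nV
    end₂   : Fin nE → Fin nV
    noLoop : ∀ e → end₁ e ≢ end₂ e

module _ (G : Multigraph) where
  open Multigraph G

  Vtx : Set
  Vtx = Fin nV

  Edge : Set
  Edge = Fin nE

  Joins : Edge → Vtx → Vtx → Set
  Joins e u v = (end₁ e ≡ u × end₂ e ≡ v) ⊎ (end₁ e ≡ v × end₂ e ≡ u)

  joins? : ∀ e u v → Dec (Joins e u v)
  joins? e u v = (end₁ e ≟ u ×-dec end₂ e ≟ v) ⊎-dec (end₁ e ≟ v ×-dec end₂ e ≟ u)

  Parallel : Edge → Edge → Set
  Parallel e g = e ≢ g × Joins g (end₁ e) (end₂ e)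

  parallel? : ∀ e g → Dec (Parallel e g)
  parallel? e g = ¬? (e ≟ g) ×-dec joins? g (end₁ e) (end₂ e)

  endOf : Edge → Bool → Vtx
  endOf e false = end₁ e
  endOf e true  = end₂ e

  -- L₂^H(G).  The vertex f(x,e) (x an end of e) is represented by the
  -- pair (e , b) with endOf e b ≡ x; since G has no loops this is a
  -- bijection onto {f(x,e)}.

  L2V : Set
  L2V = Edge × Bool

  pt : L2V → Vtx
  pt (e , b) = endOf e b

  module _ (H : Graph) (c : Edge → Graph.V H) where
    open Graph H renaming (Adj to HAdj)

    L2Adj : L2V → L2V → Set
    L2Adj (e , b) (g , b') =
        (e ≡ g × b ≢ b')
      ⊎ (endOf e b ≡ endOf g b' × e ≢ g × HAdj (c e) (c g))
      ⊎ (endOf e b ≢ endOf g b' × Parallel e g)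

    InMJ : L2V → L2V → Set
    InMJ (e , b) (g , b') = e ≡ g × b ≢ b'

    -- Dynamic H-walks.  A walk (v₀, e₀¹..e₀^{k₀}, v₁, ..., v_n) is
    -- represented by v₀ and the nonempty list of blocks
    -- ((e_i¹ ∷ ... ∷ e_i^{k_i}) , v_{i+1}), i = 0..n-1  (so n ≥ 1, k_i ≥ 1).

    DWalk : Set
    DWalk = Vtx × List⁺ (List⁺ Edge × Vtx)

    BlocksJoin : Vtx → List (List⁺ Edge × Vtx) → Set
    BlocksJoin v [] = ⊤
    BlocksJoin v ((blk , w) ∷ rest) = All (λ e → Joins e v w) (toList blk) × BlocksJoin w rest

    ColoursOK : List⁺ Edge → List (List⁺ Edge × Vtx) → Set
    ColoursOK prev [] = ⊤
    ColoursOK prev ((blk , _) ∷ rest) = HAdj (c (last prev)) (c (head blk)) × ColoursOK blk rest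

    IsDynamicWalk : DWalk → Set
    IsDynamicWalk (v₀ , (blk , v₁) ∷ rest) = BlocksJoin v₀ ((blk , v₁) ∷ rest) × ColoursOK blk rest

    walkEdges : DWalk → List Edge
    walkEdges (_ , bs) = toList (L⁺.concatMap proj₁ bs)

    IsDynamicTrail : DWalk → Set
    IsDynamicTrail W = IsDynamicWalk W × Unique (walkEdges W)

    firstVtx lastVtx secondVtx : DWalk → Vtx
    firstVtx (v₀ , _) = v₀
    secondVtx (_ , bs) = proj₂ (head bs)
    lastVtx (_ , bs) = proj₂ (last bs)

    firstEdge lastEdge : DWalk → Edge
    firstEdge (_ , bs) = head (proj₁ (head bs))
    lastEdge (_ , bs) = last (proj₁ (last bs))

    IsClosedDynamicTrail : DWalk → Set
    IsClosedDynamicTrail W =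
      IsDynamicTrail W ×
      ( (firstVtx W ≡ lastVtx W × HAdj (c (lastEdge W)) (c (firstEdge W)))
      ⊎ (secondVtx W ≡ lastVtx W × Parallel (lastEdge W) (firstEdge W)) )

  -- The construction of P from the list (e₁,s₁),...,(e_q,s_q), where
  -- x_k = endOf e_k s_k and y_k = endOf e_k (not s_k).

  xOf yOf : Edge × Bool → Vtx
  xOf (e , s) = endOf e s
  yOf (e , s) = endOf e (not s)

  LaneChange : Edge × Bool → Edge × Bool → Set
  LaneChange p k = Parallel (proj₁ p) (proj₁ k) × xOf k ≡ xOf p × yOf k ≡ yOf p

  laneChange? : ∀ p k → Dec (LaneChange p k)
  laneChange? p k = parallel? (proj₁ p) (proj₁ k) ×-dec (xOf k ≟ xOf p ×-dec yOf k ≟ yOf p)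

  -- cur = current (last) block with its end vertex, prev = (e_{k-1},s_{k-1})
  buildBlocks : List⁺ Edge × Vtx → Edge × Bool → List (Edge × Bool) → List⁺ (List⁺ Edge × Vtx)
  buildBlocks cur prev [] = [ cur ]
  buildBlocks (blk , y) prev (k ∷ ks) with laneChange? prev k
  ... | yes _ = buildBlocks (blk ⁺∷ʳ proj₁ k , yOf k) k ks
  ... | no  _ = (blk , y) L⁺.∷⁺ buildBlocks ([ proj₁ k ] , yOf k) k ks

  buildP : (Edge × Bool) → List (Edge × Bool) → Vtx × List⁺ (List⁺ Edge × Vtx)
  buildP k₁ ks = xOf k₁ , buildBlocks ([ proj₁ k₁ ] , yOf k₁) k₁ ks

cycSuc : ∀ n → Fin (suc n) → Fin (suc n)
cycSuc zero zero = zero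
cycSuc (suc n) zero = suc zero
cycSuc (suc n) (suc i) = bump (cycSuc n i)
  where
  bump : Fin (suc n) → Fin (suc (suc n))
  bump zero = zero
  bump (suc j) = suc (suc j)

next : ∀ {q} → Fin q → Fin q
next {suc n} i = cycSuc n i

-- The cycle C = (f(x₁,e₁), f(y₁,e₁), ..., f(x_q,e_q), f(y_q,e_q), f(x₁,e₁))
-- given by e_i = proj₁ (K i) and x_i = endOf e_i (proj₂ (K i)),
-- y_i = the other end of e_i.

module _ (G : Multigraph) (H : Graph) (c : Edge G → Graph.V H) where

  Xv Yv : ∀ {q} → (Fin q → Edge G × Bool) → Fin q → L2V G
  Xv K i = K i
  Yv K i = proj₁ (K i) , not (proj₂ (K i))

  cycVtx : ∀ {q} → (Fin q → Edge G × Bool) → Fin q × Bool → L2V G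
  cycVtx K (i , false) = Xv K i
  cycVtx K (i , true)  = Yv K i

  -- C is a cycle of L₂^H(G) whose edges alternate between M_J and E ∖ M_J:
  -- its 2q vertices are pairwise distinct, 2q ≥ 3 (i.e. q ≥ 2), the edges
  -- f(x_i,e_i)f(y_i,e_i) are edges in M_J and the edges
  -- f(y_i,e_i)f(x_{i+1},e_{i+1}) (indices mod q) are edges not in M_J.
  IsAlternatingCycle : ∀ {q} → (Fin q → Edge G × Bool) → Set
  IsAlternatingCycle {q} K =
      2 ≤ q
    × (∀ a b → cycVtx K a ≡ cycVtx K b → a ≡ b)
    × (∀ i → L2Adj G H c (Xv K i) (Yv K i) × InMJ G H c (Xv K i) (Yv K i))
    × (∀ i → L2Adj G H c (Yv K i) (Xv K (next i)) × ¬ InMJ G H c (Yv K i) (Xv K (next i)))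

  constructP : ∀ {r} → (Fin (suc r) → Edge G × Bool) → DWalk G H c
  constructP K = buildP G (K zero) (tabulate (λ i → K (suc i)))

{-# OPTIONS --safe #-}
-- Every edge f(y_p,e_p) f(x_k,e_k) of C outside M_J either sits at a common
-- vertex y_p = x_k, with c(e_p) c(e_k) ∈ E(H), or joins two parallel edges at
-- different ends; in the latter case the ends line up (x_k = x_p, y_k = y_p),
-- which is precisely a lane change. Hence consecutive blocks of P meet at a
-- common vertex with H-adjacent colours, while every block consists of edges
-- joining the same two vertices. The edges of P are e_1, …, e_q, which are
-- distinct because the vertices of C are, and the same dichotomy applied to
-- the closing edge f(y_q,e_q) f(x_1,e_1) gives the closing condition.
module Submission where

open import Defs
open import Data.Nat using (ℕ; zero; suc)
open import Data.Fin using (Fin; zero; suc; inject₁; fromℕ)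
open import Data.Bool using (Bool; true; false; not)
open import Data.Product using (_×_; _,_; proj₁; proj₂)
open import Data.Sum using (_⊎_; inj₁; inj₂; swap)
open import Data.Empty using (⊥-elim)
open import Data.Unit using (tt)
open import Data.List as List using (List; []; _∷_; _++_; tabulate)
open import Data.List.Properties using (++-assoc; map-tabulate)
open import Data.List.NonEmpty as List⁺ using (List⁺; _∷_; [_]; _⁺∷ʳ_; _∷⁺_; head; last; toList)
open import Data.List.Relation.Unary.All using (All; []; _∷_)
open import Data.List.Relation.Unary.All.Properties using (∷ʳ⁺)
open import Data.List.Relation.Unary.Linked using (Linked; []; [-]; _∷_)
open import Data.List.Relation.Unary.Unique.Propositional using (Unique)
open import Data.List.Relation.Unary.Unique.Propositional.Properties using (tabulate⁺)
open import Relation.Binary.PropositionalEquality using (_≡_; _≢_; refl; sym; trans; cong; subst; subst₂)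
open import Relation.Nullary using (¬_; Dec; yes; no)

module _ {a} {A : Set a} where

  last-∷ : ∀ (x y : A) ys → last (x ∷ y ∷ ys) ≡ last (y ∷ ys)
  last-∷ x y ys with List.initLast ys
  ... | []             = refl
  ... | _ List.∷ʳ′ _   = refl

  last-∷⁺ : ∀ (x : A) ys → last (x ∷⁺ ys) ≡ last ys
  last-∷⁺ x (y ∷ ys) = last-∷ x y ys

  last-∷ʳ : ∀ (xs : List A) x → last (xs List⁺.∷ʳ x) ≡ x
  last-∷ʳ []           x = refl
  last-∷ʳ (y ∷ [])     x = refl
  last-∷ʳ (y ∷ z ∷ zs) x = trans (last-∷ y z (zs List.∷ʳ x)) (last-∷ʳ (z ∷ zs) x)

  last-⁺∷ʳ : ∀ (xs : List⁺ A) x → last (xs ⁺∷ʳ x) ≡ x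
  last-⁺∷ʳ xs = last-∷ʳ (toList xs)

  All-⁺∷ʳ : ∀ {p} {P : A → Set p} xs {x} → All P (toList xs) → P x → All P (toList (xs ⁺∷ʳ x))
  All-⁺∷ʳ (_ ∷ _) = ∷ʳ⁺

  last-tabulate : ∀ {r} (f : Fin (suc r) → A) → last (f zero ∷ tabulate (λ i → f (suc i))) ≡ f (fromℕ r)
  last-tabulate {zero}  f = refl
  last-tabulate {suc r} f =
    trans (last-∷ (f zero) (f (suc zero)) (tabulate (λ i → f (suc (suc i))))) (last-tabulate (λ i → f (suc i)))

  Linked-tabulate : ∀ {ℓ} {R : A → A → Set ℓ} {r} (f : Fin (suc r) → A) →
                    (∀ i → R (f (inject₁ i)) (f (suc i))) → Linked R (tabulate f)
  Linked-tabulate {r = zero}  f steps = [-]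
  Linked-tabulate {r = suc r} f steps =
    steps zero ∷ Linked-tabulate (λ i → f (suc i)) (λ i → steps (suc i))

cycSuc-inject₁ : ∀ n (i : Fin n) → cycSuc n (inject₁ i) ≡ suc i
cycSuc-inject₁ (suc n) zero    = refl
cycSuc-inject₁ (suc n) (suc i) rewrite cycSuc-inject₁ n i = refl

cycSuc-fromℕ : ∀ n → cycSuc n (fromℕ n) ≡ zero
cycSuc-fromℕ zero    = refl
cycSuc-fromℕ (suc n) rewrite cycSuc-fromℕ n = refl

module _ (G : Multigraph) where
  open Multigraph G

  joins-ends : ∀ k → Joins G (proj₁ k) (xOf G k) (yOf G k)
  joins-ends (g , false) = inj₁ (refl , refl)
  joins-ends (g , true)  = inj₂ (refl , refl)

  joins-endOf : ∀ {g} e s → Joins G g (end₁ e) (end₂ e) → Joins G g (endOf G e s) (endOf G e (not s))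
  joins-endOf e false j = j
  joins-endOf e true  j = swap j

  joins-orient : ∀ {g u v} t → Joins G g u v →
                 (endOf G g t ≡ u × endOf G g (not t) ≡ v) ⊎ (endOf G g t ≡ v × endOf G g (not t) ≡ u)
  joins-orient false j                = j
  joins-orient true  (inj₁ (e₁ , e₂)) = inj₂ (e₂ , e₁)
  joins-orient true  (inj₂ (e₁ , e₂)) = inj₁ (e₂ , e₁)

  parallel-laneChange : ∀ p k → Parallel G (proj₁ p) (proj₁ k) → yOf G p ≢ xOf G k → LaneChange G p k
  parallel-laneChange (e , s) (g , t) par@(_ , j) y≢x with joins-orient t (joins-endOf e s j)
  ... | inj₁ (x≡x , y≡y) = par , x≡x , y≡y
  ... | inj₂ (x≡y , _)   = ⊥-elim (y≢x (sym x≡y))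

  headEdge-buildBlocks : ∀ blk y prev ks → head (proj₁ (head (buildBlocks G (blk , y) prev ks))) ≡ head blk
  headEdge-buildBlocks blk y prev []       = refl
  headEdge-buildBlocks blk y prev (k ∷ ks) with laneChange? G prev k
  ... | yes _ = headEdge-buildBlocks (blk ⁺∷ʳ proj₁ k) (yOf G k) k ks
  ... | no  _ = refl

  headVertex-buildBlocks : ∀ blk prev ks → proj₂ (head (buildBlocks G (blk , yOf G prev) prev ks)) ≡ yOf G prev
  headVertex-buildBlocks blk prev []       = refl
  headVertex-buildBlocks blk prev (k ∷ ks) with laneChange? G prev k
  ... | yes (_ , _ , y≡y) = trans (headVertex-buildBlocks (blk ⁺∷ʳ proj₁ k) k ks) y≡y
  ... | no  _             = refl

  lastVertex-buildBlocks : ∀ blk prev ks →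
                           proj₂ (last (buildBlocks G (blk , yOf G prev) prev ks)) ≡ yOf G (last (prev ∷ ks))
  lastVertex-buildBlocks blk prev []       = refl
  lastVertex-buildBlocks blk prev (k ∷ ks) with laneChange? G prev k
  ... | yes _ = trans (lastVertex-buildBlocks (blk ⁺∷ʳ proj₁ k) k ks) (cong (yOf G) (sym (last-∷ prev k ks)))
  ... | no  _ =
    trans (cong proj₂ (last-∷⁺ (blk , yOf G prev) (buildBlocks G ([ proj₁ k ] , yOf G k) k ks)))
          (trans (lastVertex-buildBlocks [ proj₁ k ] k ks) (cong (yOf G) (sym (last-∷ prev k ks))))

  lastEdge-buildBlocks : ∀ blk y prev ks → last blk ≡ proj₁ prev →
                         last (proj₁ (last (buildBlocks G (blk , y) prev ks))) ≡ proj₁ (last (prev ∷ ks))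
  lastEdge-buildBlocks blk y prev []       blk-ends = blk-ends
  lastEdge-buildBlocks blk y prev (k ∷ ks) blk-ends with laneChange? G prev k
  ... | yes _ =
    trans (lastEdge-buildBlocks (blk ⁺∷ʳ proj₁ k) (yOf G k) k ks (last-⁺∷ʳ blk (proj₁ k)))
          (cong proj₁ (sym (last-∷ prev k ks)))
  ... | no  _ =
    trans (cong (λ b → last (proj₁ b)) (last-∷⁺ (blk , y) (buildBlocks G ([ proj₁ k ] , yOf G k) k ks)))
          (trans (lastEdge-buildBlocks [ proj₁ k ] (yOf G k) k ks refl) (cong proj₁ (sym (last-∷ prev k ks))))

  edges-buildBlocks : ∀ blk y prev ks →
                      toList (List⁺.concatMap proj₁ (buildBlocks G (blk , y) prev ks)) ≡ toList blk ++ List.map proj₁ ks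
  edges-buildBlocks blk y prev []       = refl
  edges-buildBlocks blk y prev (k ∷ ks) with laneChange? G prev k
  ... | yes _ =
    trans (edges-buildBlocks (blk ⁺∷ʳ proj₁ k) (yOf G k) k ks) (++-assoc (toList blk) (proj₁ k ∷ []) (List.map proj₁ ks))
  ... | no  _ = cong (toList blk ++_) (edges-buildBlocks [ proj₁ k ] (yOf G k) k ks)

module _ (G : Multigraph) (H : Graph) (c : Edge G → Graph.V H) where
  open Graph H using () renaming (Adj to HAdj)

  NonMatchingEdge : Edge G × Bool → Edge G × Bool → Set
  NonMatchingEdge p k = L2Adj G H c (proj₁ p , not (proj₂ p)) k × ¬ InMJ G H c (proj₁ p , not (proj₂ p)) k

  ColourStep : Edge G × Bool → Edge G × Bool → Set
  ColourStep p k = yOf G p ≡ xOf G k × HAdj (c (proj₁ p)) (c (proj₁ k))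

  colourStep-unless-laneChange : ∀ p k → NonMatchingEdge p k → ¬ LaneChange G p k → ColourStep p k
  colourStep-unless-laneChange p k (inj₁ matched , unmatched) _ = ⊥-elim (unmatched matched)
  colourStep-unless-laneChange p k (inj₂ (inj₁ (y≡x , _ , adj)) , _) _ = y≡x , adj
  colourStep-unless-laneChange p k (inj₂ (inj₂ (y≢x , par)) , _) noLaneChange =
    ⊥-elim (noLaneChange (parallel-laneChange G p k par y≢x))

  walk-buildBlocks : ∀ {v} blk prev ks →
                     All (λ e → Joins G e v (yOf G prev)) (toList blk) → last blk ≡ proj₁ prev → xOf G prev ≡ v →
                     Linked NonMatchingEdge (prev ∷ ks) →
                     IsDynamicWalk G H c (v , buildBlocks G (blk , yOf G prev) prev ks)
  walk-buildBlocks blk prev [] blk-joins _ _ _ = (blk-joins , tt) , tt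
  walk-buildBlocks {v} blk prev (k ∷ ks) blk-joins blk-ends x≡v (edge ∷ edges) with laneChange? G prev k
  ... | yes (_ , x≡x , y≡y) =
    walk-buildBlocks (blk ⁺∷ʳ proj₁ k) k ks blk′-joins (last-⁺∷ʳ blk (proj₁ k)) (trans x≡x x≡v) edges
    where
    blk′-joins : All (λ e → Joins G e v (yOf G k)) (toList (blk ⁺∷ʳ proj₁ k))
    blk′-joins = All-⁺∷ʳ blk (subst (λ w → All (λ e → Joins G e v w) (toList blk)) (sym y≡y) blk-joins)
                             (subst (λ u → Joins G (proj₁ k) u (yOf G k)) (trans x≡x x≡v) (joins-ends G k))
  ... | no noLaneChange = (blk-joins , proj₁ rest-walk) , (colours-meet , proj₂ rest-walk)
    where
    rest : List⁺ (List⁺ (Edge G) × Vtx G)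
    rest = buildBlocks G ([ proj₁ k ] , yOf G k) k ks
    step : ColourStep prev k
    step = colourStep-unless-laneChange prev k edge noLaneChange
    rest-walk : IsDynamicWalk G H c (yOf G prev , rest)
    rest-walk = walk-buildBlocks [ proj₁ k ] k ks
                  (subst (λ u → Joins G (proj₁ k) u (yOf G k)) (sym (proj₁ step)) (joins-ends G k) ∷ [])
                  refl (sym (proj₁ step)) edges
    colours-meet : HAdj (c (last blk)) (c (head (proj₁ (head rest))))
    colours-meet = subst₂ (λ a b → HAdj (c a) (c b)) (sym blk-ends)
                     (sym (headEdge-buildBlocks G [ proj₁ k ] (yOf G k) k ks)) (proj₂ step)

  walk-buildP : ∀ k₁ ks → Linked NonMatchingEdge (k₁ ∷ ks) → IsDynamicWalk G H c (buildP G k₁ ks)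
  walk-buildP k₁ ks = walk-buildBlocks [ proj₁ k₁ ] k₁ ks (joins-ends G k₁ ∷ []) refl refl

  edges-buildP : ∀ k₁ ks → walkEdges G H c (buildP G k₁ ks) ≡ List.map proj₁ (k₁ ∷ ks)
  edges-buildP k₁ ks = edges-buildBlocks G [ proj₁ k₁ ] (yOf G k₁) k₁ ks

  Closes : DWalk G H c → Set
  Closes W = (firstVtx G H c W ≡ lastVtx G H c W × HAdj (c (lastEdge G H c W)) (c (firstEdge G H c W)))
           ⊎ (secondVtx G H c W ≡ lastVtx G H c W × Parallel G (lastEdge G H c W) (firstEdge G H c W))

  closes-buildP : ∀ k₁ ks → NonMatchingEdge (last (k₁ ∷ ks)) k₁ → Closes (buildP G k₁ ks)
  closes-buildP k₁ ks closing = closes (laneChange? G kₙ k₁)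
    where
    kₙ : Edge G × Bool
    kₙ = last (k₁ ∷ ks)

    P : DWalk G H c
    P = buildP G k₁ ks

    last-vertex : lastVtx G H c P ≡ yOf G kₙ
    last-vertex = lastVertex-buildBlocks G [ proj₁ k₁ ] k₁ ks

    last-edge : lastEdge G H c P ≡ proj₁ kₙ
    last-edge = lastEdge-buildBlocks G [ proj₁ k₁ ] (yOf G k₁) k₁ ks refl

    first-edge : firstEdge G H c P ≡ proj₁ k₁
    first-edge = headEdge-buildBlocks G [ proj₁ k₁ ] (yOf G k₁) k₁ ks

    closes : Dec (LaneChange G kₙ k₁) → Closes P
    closes (yes (par , _ , y≡y)) =
      inj₂ (trans (headVertex-buildBlocks G [ proj₁ k₁ ] k₁ ks) (trans y≡y (sym last-vertex)) ,
            subst₂ (Parallel G) (sym last-edge) (sym first-edge) par)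
    closes (no noLaneChange) =
      inj₁ (sym (trans last-vertex (proj₁ step)) ,
            subst₂ (λ a b → HAdj (c a) (c b)) (sym last-edge) (sym first-edge) (proj₂ step))
      where
      step : ColourStep kₙ k₁
      step = colourStep-unless-laneChange kₙ k₁ closing noLaneChange

  cycVtx-canonical : ∀ {q} (K : Fin q → Edge G × Bool) i → cycVtx G H c K (i , proj₂ (K i)) ≡ (proj₁ (K i) , false)
  cycVtx-canonical K i with proj₂ (K i) in s≡
  ... | false = cong (proj₁ (K i) ,_) s≡
  ... | true  = cong (λ s → proj₁ (K i) , not s) s≡

  edges-injective : ∀ {q} (K : Fin q → Edge G × Bool) →
                    (∀ a b → cycVtx G H c K a ≡ cycVtx G H c K b → a ≡ b) →
                    ∀ {i j} → proj₁ (K i) ≡ proj₁ (K j) → i ≡ j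
  edges-injective K distinct {i} {j} e≡e =
    cong proj₁ (distinct (i , proj₂ (K i)) (j , proj₂ (K j))
      (trans (cycVtx-canonical K i) (trans (cong (_, false) e≡e) (sym (cycVtx-canonical K j)))))

lemma3 : (H : Graph) (G : Multigraph) (c : Edge G → Graph.V H)
         (r : ℕ) (K : Fin (suc r) → Edge G × Bool) →
         IsAlternatingCycle G H c K →
         IsClosedDynamicTrail G H c (constructP G H c K)
lemma3 H G c r K (_ , distinct , _ , nonMatching) =
  (walk-buildP G H c (K zero) ks (Linked-tabulate K steps) , unique) ,
  closes-buildP G H c (K zero) ks closing
  where
  ks : List (Edge G × Bool)
  ks = tabulate (λ i → K (suc i))

  steps : ∀ i → NonMatchingEdge G H c (K (inject₁ i)) (K (suc i))
  steps i = subst (λ j → NonMatchingEdge G H c (K (inject₁ i)) (K j)) (cycSuc-inject₁ r i) (nonMatching (inject₁ i))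

  closing : NonMatchingEdge G H c (last (K zero ∷ ks)) (K zero)
  closing = subst₂ (λ p j → NonMatchingEdge G H c p (K j)) (sym (last-tabulate K)) (cycSuc-fromℕ r)
                   (nonMatching (fromℕ r))

  unique : Unique (walkEdges G H c (constructP G H c K))
  unique = subst Unique (sym (trans (edges-buildP G H c (K zero) ks) (map-tabulate K proj₁)))
                 (tabulate⁺ (edges-injective G H c K distinct))
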